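{- Let $\mathbb{K}$ be a commutative ring, $n$ a positive integer, and $f:\{1,\ldots,n\}\to\{1,\ldots,n\}$ a map with $f(n)=n$. Let $Z_f=\left(\delta_{i,j}-(1-\delta_{i,n})\delta_{f(i),j}\right)_{1\le i\le n,\ 1\le j\le n}\in\mathbb{K}^{n\times n}$, and let $v_f\in\mathbb{K}^{n\times 1}$ be the column vector whose $i$-th entry is $1-\delta_{f^{n-1}(i),n}$. Then $Z_f v_f=0_{n\times1}$ (the zero column vector).
   Context: $\delta_{a,b}$ is $1$ if $a=b$ and $0$ otherwise; $f^k$ denotes the $k$-fold composite of $f$, with $f^0=\mathrm{id}$. -}

module Defs where

open import Level using (Level)
open import Data.Nat using (ℕ; zero; suc)
open import Data.Fin using (Fin; _≟_)
open import Relation.Nullary using (yes; no)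
open import Algebra.Bundles using (CommutativeRing)

iter : {A : Set} → (A → A) → ℕ → A → A
iter f zero    x = x
iter f (suc k) x = f (iter f k x)

module _ {c ℓ : Level} (R : CommutativeRing c ℓ) where
  open CommutativeRing R

  δ : {n : ℕ} → Fin n → Fin n → Carrier
  δ a b with a ≟ b
  ... | yes _ = 1#
  ... | no  _ = 0#

  Σ : (n : ℕ) → (Fin n → Carrier) → Carrier
  Σ zero    g = 0#
  Σ (suc n) g = g Fin.zero + Σ n (λ i → g (Fin.suc i))

  -- matrices K^{m×n} as functions, column vectors K^{n×1} as Fin n → K
  Matrix : ℕ → ℕ → Set c
  Matrix m n = Fin m → Fin n → Carrier

  _·ᵥ_ : {m n : ℕ} → Matrix m n → (Fin n → Carrier) → (Fin m → Carrier)
  (A ·ᵥ v) i = Σ _ (λ j → A i j * v j)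

-- Row i of Z_f v_f is v_f(i) − (1 − δ_{i,n}) v_f(f i). Since n is a fixed point of f, an orbit
-- of f that reaches n does so within n − 1 steps (otherwise, by pigeonhole, it would repeat a
-- point first and could be shortcut). Hence f^{n-1}(f i) = n iff f^{n-1}(i) = n, i.e.
-- v_f(f i) = v_f(i). Finally the coefficient 1 − δ_{i,n} is 1 unless i = n, where v_f(n) = 0.
module Submission where

open import Defs
open import Level using (Level)
open import Data.Nat using (ℕ; zero; suc; z≤n; _≤_; _<_; _≤′_; ≤′-refl; ≤′-step)
open import Data.Nat.Properties using (≤⇒≤′; m∸n+n≡m; +-monoʳ-<; ≤-pred; ≤-reflexive; ≤-trans; n<1+n)
open import Data.Fin using (Fin; fromℕ; toℕ; _≟_; punchOut; punchIn)
open import Data.Fin.Properties using (pigeonhole; punchOut-injective; punchInᵢ≢i; toℕ≤pred[n]; toℕ≤n)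
open import Data.Product using (_,_; _×_; ∃-syntax)
open import Data.Empty using (⊥-elim)
open import Function using (_∘_; _⇔_; mk⇔; Equivalence)
open import Relation.Nullary using (Dec; yes; no)
open import Relation.Binary.PropositionalEquality as ≡ using (_≡_; _≢_; cong; module ≡-Reasoning)
open import Algebra.Bundles using (CommutativeRing)

module _ {A : Set} (f : A → A) where
  open Data.Nat using (_+_; _∸_)

  iter-+ : ∀ k l x → iter f (k + l) x ≡ iter f k (iter f l x)
  iter-+ zero    l x = ≡.refl
  iter-+ (suc k) l x = cong f (iter-+ k l x)

  iter-∘ : ∀ k x → iter f k (f x) ≡ iter f (suc k) x
  iter-∘ zero    x = ≡.refl
  iter-∘ (suc k) x = cong f (iter-∘ k x)

  iter-shortcut : ∀ {i j l x} → i < j → j ≤ l → iter f i x ≡ iter f j x →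
                  ∃[ k ] k < l × iter f k x ≡ iter f l x
  iter-shortcut {i} {j} {l} {x} i<j j≤l fi≡fj =
    l ∸ j + i , ≤-trans (+-monoʳ-< (l ∸ j) i<j) (≤-reflexive (m∸n+n≡m j≤l)) , (begin
      iter f (l ∸ j + i) x        ≡⟨ iter-+ (l ∸ j) i x ⟩
      iter f (l ∸ j) (iter f i x) ≡⟨ cong (iter f (l ∸ j)) fi≡fj ⟩
      iter f (l ∸ j) (iter f j x) ≡⟨ iter-+ (l ∸ j) j x ⟨
      iter f (l ∸ j + j) x        ≡⟨ cong (λ t → iter f t x) (m∸n+n≡m j≤l) ⟩
      iter f l x                  ∎)
    where open ≡-Reasoning

  iter-≡-fixedPoint-mono : ∀ {a k l x} → f a ≡ a → k ≤ l → iter f k x ≡ a → iter f l x ≡ a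
  iter-≡-fixedPoint-mono {a} {k} {x = x} fa≡a k≤l hit = go (≤⇒≤′ k≤l)
    where
    go : ∀ {l} → k ≤′ l → iter f l x ≡ a
    go ≤′-refl        = hit
    go (≤′-step k≤′l) = ≡.trans (cong f (go k≤′l)) fa≡a

module _ {m : ℕ} (f : Fin (suc m) → Fin (suc m)) {a : Fin (suc m)} (fa≡a : f a ≡ a) where

  private
    earlierMisses : ∀ {x} → iter f m x ≢ a → (k : Fin (suc m)) → a ≢ iter f (toℕ k) x
    earlierMisses miss k = miss ∘ iter-≡-fixedPoint-mono f fa≡a (toℕ≤pred[n] k) ∘ ≡.sym

  iter-suc-≡-fixedPoint⇒iter-≡ : ∀ x → iter f (suc m) x ≡ a → iter f m x ≡ a
  iter-suc-≡-fixedPoint⇒iter-≡ x hit with iter f m x ≟ a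
  ... | yes earlyHit = earlyHit
  ... | no  miss
    -- f^0 x, …, f^m x avoid a, so punching a out sends them into Fin m, where two coincide
    with i , j , i<j , same ← pigeonhole (n<1+n m) (λ k → punchOut (earlierMisses miss k))
    with k , k<suc-m , fk≡fsuc-m ← iter-shortcut f i<j (toℕ≤n j)
                                     (punchOut-injective (earlierMisses miss i) (earlierMisses miss j) same)
    = ⊥-elim (miss (iter-≡-fixedPoint-mono f fa≡a (≤-pred k<suc-m) (≡.trans fk≡fsuc-m hit)))

  iter-∘-≡-fixedPoint⇔ : ∀ x → iter f m (f x) ≡ a ⇔ iter f m x ≡ a
  iter-∘-≡-fixedPoint⇔ x = mk⇔
    (iter-suc-≡-fixedPoint⇒iter-≡ x ∘ ≡.trans (≡.sym (iter-∘ f m x)))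
    (λ hit → ≡.trans (iter-∘ f m x) (≡.trans (cong f hit) fa≡a))

module _ {c ℓ : Level} (R : CommutativeRing c ℓ) where
  open CommutativeRing R
  open import Algebra.Properties.Ring ring using (-‿distribˡ-*; -0#≈0#)
  open import Algebra.Properties.Semiring.Sum semiring
    using (sum; sum-cong-≋; sum-replicate-zero; sum-remove; ∑-distrib-+; *-distribˡ-sum)
  open import Relation.Binary.Reasoning.Setoid setoid

  δ-≡ : ∀ {n} {a b : Fin n} → a ≡ b → δ R a b ≈ 1#
  δ-≡ {a = a} {b} a≡b with a ≟ b
  ... | yes _   = refl
  ... | no  a≢b = ⊥-elim (a≢b a≡b)

  δ-≢ : ∀ {n} {a b : Fin n} → a ≢ b → δ R a b ≈ 0#
  δ-≢ {a = a} {b} a≢b with a ≟ b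
  ... | yes a≡b = ⊥-elim (a≢b a≡b)
  ... | no  _   = refl

  δ-cong-⇔ : ∀ {n} {a b c d : Fin n} → (a ≡ b ⇔ c ≡ d) → δ R a b ≈ δ R c d
  δ-cong-⇔ {a = a} {b} a≡b⇔c≡d with a ≟ b
  ... | yes a≡b = sym (δ-≡ (Equivalence.to a≡b⇔c≡d a≡b))
  ... | no  a≢b = sym (δ-≢ (a≢b ∘ Equivalence.from a≡b⇔c≡d))

  Σ≡sum : ∀ n (g : Fin n → Carrier) → Σ R n g ≡ sum g
  Σ≡sum zero    g = ≡.refl
  Σ≡sum (suc n) g = cong (g Fin.zero +_) (Σ≡sum n (g ∘ Fin.suc))

  sum-δ : ∀ {n} (a : Fin n) (g : Fin n → Carrier) → sum (λ j → δ R a j * g j) ≈ g a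
  sum-δ {suc n} a g = begin
    sum (λ j → δ R a j * g j)                     ≈⟨ sum-remove {i = a} (λ j → δ R a j * g j) ⟩
    δ R a a * g a + sum (λ k → δ R a (punchIn a k) * g (punchIn a k))
      ≈⟨ +-cong diagonal (trans (sum-cong-≋ offDiagonal) (sum-replicate-zero n)) ⟩
    g a + 0#                                      ≈⟨ +-identityʳ (g a) ⟩
    g a                                           ∎
    where
    diagonal : δ R a a * g a ≈ g a
    diagonal = trans (*-congʳ (δ-≡ {a = a} ≡.refl)) (*-identityˡ (g a))
    offDiagonal : ∀ k → δ R a (punchIn a k) * g (punchIn a k) ≈ 0#
    offDiagonal k = trans (*-congʳ (δ-≢ (punchInᵢ≢i a k ∘ ≡.sym))) (zeroˡ _)

  ·ᵥ-δ-sub-scaled-δ : ∀ {n} (κ : Fin n → Carrier) (h : Fin n → Fin n) (v : Fin n → Carrier) i →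
    _·ᵥ_ R (λ i j → δ R i j - κ i * δ R (h i) j) v i ≈ v i - κ i * v (h i)
  ·ᵥ-δ-sub-scaled-δ {n} κ h v i = begin
    Σ R n (λ j → (δ R i j - κ i * δ R (h i) j) * v j)
      ≡⟨ Σ≡sum n _ ⟩
    sum (λ j → (δ R i j - κ i * δ R (h i) j) * v j)
      ≈⟨ sum-cong-≋ (λ j → expand (δ R i j) (δ R (h i) j) (v j)) ⟩
    sum (λ j → δ R i j * v j + - κ i * (δ R (h i) j * v j))
      ≈⟨ ∑-distrib-+ (λ j → δ R i j * v j) (λ j → - κ i * (δ R (h i) j * v j)) ⟩
    sum (λ j → δ R i j * v j) + sum (λ j → - κ i * (δ R (h i) j * v j))
      ≈⟨ +-congˡ (*-distribˡ-sum (- κ i) (λ j → δ R (h i) j * v j)) ⟨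
    sum (λ j → δ R i j * v j) + - κ i * sum (λ j → δ R (h i) j * v j)
      ≈⟨ +-cong (sum-δ i v) (*-congˡ (sum-δ (h i) v)) ⟩
    v i + - κ i * v (h i)
      ≈⟨ +-congˡ (-‿distribˡ-* (κ i) (v (h i))) ⟨
    v i - κ i * v (h i) ∎
    where
    expand : ∀ x y z → (x - κ i * y) * z ≈ x * z + - κ i * (y * z)
    expand x y z = begin
      (x - κ i * y) * z           ≈⟨ distribʳ z x _ ⟩
      x * z + - (κ i * y) * z     ≈⟨ +-congˡ (*-congʳ (-‿distribˡ-* (κ i) y)) ⟩
      x * z + - κ i * y * z       ≈⟨ +-congˡ (*-assoc (- κ i) y z) ⟩
      x * z + - κ i * (y * z)     ∎

  notAbsorbed : ∀ {m} → (Fin (suc m) → Fin (suc m)) → Fin (suc m) → Fin (suc m) → Carrier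
  notAbsorbed {m} f a i = 1# - δ R (iter f m i) a

  module _ {m} {f : Fin (suc m) → Fin (suc m)} {a : Fin (suc m)} (fa≡a : f a ≡ a) where

    notAbsorbed-∘ : ∀ i → notAbsorbed f a (f i) ≈ notAbsorbed f a i
    notAbsorbed-∘ i = +-congˡ (-‿cong (δ-cong-⇔ (iter-∘-≡-fixedPoint⇔ f fa≡a i)))

    notAbsorbed-fixedPoint : notAbsorbed f a a ≈ 0#
    notAbsorbed-fixedPoint = begin
      1# - δ R (iter f m a) a ≈⟨ +-congˡ (-‿cong (δ-≡ (iter-≡-fixedPoint-mono f fa≡a (z≤n {m}) ≡.refl))) ⟩
      1# - 1#                 ≈⟨ -‿inverseʳ 1# ⟩
      0#                      ∎

    [1-δ]*notAbsorbed : ∀ i → (1# - δ R i a) * notAbsorbed f a i ≈ notAbsorbed f a i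
    [1-δ]*notAbsorbed i = byCases (i ≟ a)
      where
      byCases : Dec (i ≡ a) → (1# - δ R i a) * notAbsorbed f a i ≈ notAbsorbed f a i
      byCases (yes ≡.refl) = begin
        (1# - δ R a a) * notAbsorbed f a a ≈⟨ *-congˡ notAbsorbed-fixedPoint ⟩
        (1# - δ R a a) * 0#               ≈⟨ zeroʳ _ ⟩
        0#                                ≈⟨ notAbsorbed-fixedPoint ⟨
        notAbsorbed f a a                 ∎
      byCases (no i≢a) = begin
        (1# - δ R i a) * notAbsorbed f a i ≈⟨ *-congʳ (+-congˡ (-‿cong (δ-≢ i≢a))) ⟩
        (1# - 0#) * notAbsorbed f a i      ≈⟨ *-congʳ (trans (+-congˡ -0#≈0#) (+-identityʳ 1#)) ⟩
        1# * notAbsorbed f a i             ≈⟨ *-identityˡ _ ⟩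
        notAbsorbed f a i                  ∎

proposition3p10 : {c ℓ : Level} (R : CommutativeRing c ℓ) (m : ℕ)
  (f : Fin (suc m) → Fin (suc m)) → f (fromℕ m) ≡ fromℕ m →
  let open CommutativeRing R
      Z : Matrix R (suc m) (suc m)
      Z i j = δ R i j - ((1# - δ R i (fromℕ m)) * δ R (f i) j)
      v : Fin (suc m) → Carrier
      v i = 1# - δ R (iter f m i) (fromℕ m)
  in ∀ (i : Fin (suc m)) → _·ᵥ_ R Z v i ≈ 0#
proposition3p10 R m f fn≡n i = begin
  _·ᵥ_ R (λ i j → δ R i j - κ i * δ R (f i) j) v i ≈⟨ ·ᵥ-δ-sub-scaled-δ R κ f v i ⟩
  v i - κ i * v (f i)                             ≈⟨ +-congˡ (-‿cong (*-congˡ (notAbsorbed-∘ R fn≡n i))) ⟩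
  v i - κ i * v i                                 ≈⟨ +-congˡ (-‿cong ([1-δ]*notAbsorbed R fn≡n i)) ⟩
  v i - v i                                       ≈⟨ -‿inverseʳ (v i) ⟩
  0#                                              ∎
  where
  open CommutativeRing R
  open import Relation.Binary.Reasoning.Setoid setoid
  κ : Fin (suc m) → Carrier
  κ i = 1# - δ R i (fromℕ m)
  v : Fin (suc m) → Carrier
  v = notAbsorbed R f (fromℕ m)
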